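{- (i) For $n\geq 2$ and $m\geq 2$, $2\leq pc(P_n\Box P_m)\leq 3$. (ii) For $n\geq 2$ and $m\geq 2$: $pc(P_n\circ P_m)=1$ if $m=n=2$, and $pc(P_n\circ P_m)=2$ if ($m=2$ and $n>2$) or ($n=2$ and $m>2$) or ($m,n>2$).
   Context: $P_k$ denotes the path on $k$ vertices. In an edge-colored graph (adjacent edges may receive the same color), a path is a proper path if no two adjacent edges of the path have the same color. The proper connection number $pc(G)$ of a connected graph $G$ is the minimum number of colors in an edge-coloring of $G$ such that every two distinct vertices are joined by a proper path. The Cartesian product $G\Box H$ has vertex set $V(G)\times V(H)$, with $(g,h)\sim(g',h')$ iff ($g=g'$ and $hh'\in E(H)$) or ($h=h'$ and $gg'\in E(G)$). The lexicographic product $G\circ H$ has vertex set $V(G)\times V(H)$, with $(g,h)\sim(g',h')$ iff $gg'\in E(G)$, or ($g=g'$ and $hh'\in E(H)$). -}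

module Defs where

open import Data.Nat using (ℕ; suc; _≤_)
open import Data.Fin using (Fin; toℕ)
open import Data.Product using (Σ; ∃; _×_; _,_)
open import Data.Sum using (_⊎_)
open import Data.Unit using (⊤)
open import Data.Maybe using (Maybe; just)
open import Data.List using (List; []; _∷_; head; last)
open import Data.List.Relation.Unary.Unique.Propositional using (Unique)
open import Relation.Nullary using (¬_)
open import Relation.Binary.PropositionalEquality using (_≡_; _≢_)

record Graph : Set₁ where
  field
    V   : Set
    _~_ : V → V → Set
open Graph public

P : ℕ → Graph
P k = record { V = Fin k ; _~_ = λ i j → (toℕ j ≡ suc (toℕ i)) ⊎ (toℕ i ≡ suc (toℕ j)) }

_□_ : Graph → Graph → Graph
G □ H = record
  { V = V G × V H
  ; _~_ = λ { (g , h) (g' , h') →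
        (g ≡ g' × _~_ H h h') ⊎ (h ≡ h' × _~_ G g g') } }

_∘L_ : Graph → Graph → Graph
G ∘L H = record
  { V = V G × V H
  ; _~_ = λ { (g , h) (g' , h') →
        _~_ G g g' ⊎ (g ≡ g' × _~_ H h h') } }

-- An edge-colouring of G with (at most) k colours: a colour for each
-- ordered pair, symmetric on edges (only values on edges matter).
record Colouring (G : Graph) (k : ℕ) : Set where
  field
    col : V G → V G → Fin k
    sym : ∀ u v → _~_ G u v → col u v ≡ col v u
open Colouring public

module _ (G : Graph) where
  Consecutive : List (V G) → Set
  Consecutive []            = ⊤
  Consecutive (x ∷ [])      = ⊤
  Consecutive (x ∷ y ∷ r)   = _~_ G x y × Consecutive (y ∷ r)

  ProperColours : ∀ {k} → Colouring G k → List (V G) → Set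
  ProperColours c (x ∷ y ∷ z ∷ r) = col c x y ≢ col c y z × ProperColours c (y ∷ z ∷ r)
  ProperColours c _               = ⊤

  ProperPath : ∀ {k} → Colouring G k → V G → V G → List (V G) → Set
  ProperPath c u v ps =
    head ps ≡ just u × last ps ≡ just v × Unique ps × Consecutive ps × ProperColours c ps

  ProperlyConnected : ∀ {k} → Colouring G k → Set
  ProperlyConnected c = ∀ u v → u ≢ v → ∃ λ ps → ProperPath c u v ps

  PCColourable : ℕ → Set
  PCColourable k = Σ (Colouring G k) ProperlyConnected

  PC≡ : ℕ → Set
  PC≡ k = PCColourable k × (∀ j → PCColourable j → k ≤ j)

-- A Hamiltonian path v₀ v₁ … v_L makes a graph properly connected with two colours:
-- colour every edge by the parity of the smaller position of its ends.  Any two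
-- vertices are then joined by a segment of the Hamiltonian path, whose consecutive
-- edges get consecutive, hence different, parities.  Both P_n □ P_m and P_n ∘ P_m
-- contain the boustrophedon path through the grid, traversing the rows alternately
-- left-to-right and right-to-left.  Two colours are also necessary as soon as two
-- distinct vertices are non-adjacent, since with one colour a proper path has at
-- most one edge; P_2 ∘ P_2 = K₄ is complete, so one colour suffices there.
module Submission where

open import Defs hiding (sym)
open import Data.Empty using (⊥-elim)
open import Data.Fin using (Fin; toℕ) renaming (zero to fzero; suc to fsuc)
open import Data.Fin.Properties as Fin using (toℕ-injective; toℕ-fromℕ<; toℕ≤pred[n])
open import Data.List using (List; []; _∷_; applyUpTo; last)
open import Data.List.Relation.Unary.All using ([]; _∷_)
open import Data.List.Relation.Unary.AllPairs using ([]; _∷_)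
import Data.List.Relation.Unary.Unique.Propositional.Properties as Unique
open import Data.Maybe using (just)
open import Data.Maybe.Properties using (just-injective)
open import Data.Nat using (ℕ; zero; suc; _+_; _*_; _∸_; _⊓_; _≤_; _<_; z≤n; s≤s; NonZero)
open import Data.Nat.DivMod
open import Data.Nat.Properties
open import Data.Product using (_×_; _,_; proj₂; ∃)
open import Data.Sum using (_⊎_; inj₁; inj₂; [_,_]′)
open import Data.Unit using (tt)
open import Function using (_∘_)
open import Relation.Binary.Definitions using (DecidableEquality)
open import Relation.Binary.PropositionalEquality
open import Relation.Nullary using (¬_; yes; no)

suc[m∸1+n]≡m∸n : ∀ {m n} → n < m → suc (m ∸ suc n) ≡ m ∸ n
suc[m∸1+n]≡m∸n {m} n<m = sym (+-∸-assoc 1 n<m)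

m∸[1+n]<m : ∀ {m n} → n < m → m ∸ suc n < m
m∸[1+n]<m {m} {n} n<m = subst (_≤ m) (sym (suc[m∸1+n]≡m∸n n<m)) (m∸n≤m m n)

m<n⇒[m+kn]%n≡m : ∀ {m n} k .{{_ : NonZero n}} → m < n → (m + k * n) % n ≡ m
m<n⇒[m+kn]%n≡m {m} {n} k m<n = trans ([m+kn]%n≡m%n m k n) (m<n⇒m%n≡m m<n)

m<n⇒[m+kn]/n≡k : ∀ {m n} k .{{_ : NonZero n}} → m < n → (m + k * n) / n ≡ k
m<n⇒[m+kn]/n≡k {m} {n} k m<n = begin
  (m + k * n) / n     ≡⟨ +-distrib-/ m (k * n) no-carry ⟩
  m / n + k * n / n   ≡⟨ cong₂ _+_ (m<n⇒m/n≡0 m<n) (m*n/n≡m k n) ⟩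
  k                   ∎
  where
  open ≡-Reasoning
  no-carry : m % n + k * n % n < n
  no-carry = subst (_< n) (sym (trans (cong₂ _+_ (m<n⇒m%n≡m m<n) (m*n%n≡0 k n)) (+-identityʳ m))) m<n

last-applyUpTo : ∀ {A : Set} (f : ℕ → A) d → last (applyUpTo f (suc d)) ≡ just (f d)
last-applyUpTo f zero    = refl
last-applyUpTo f (suc d) = last-applyUpTo (λ t → f (suc t)) d

Symmetric : Graph → Set
Symmetric G = ∀ {u v} → _~_ G u v → _~_ G v u

Complete : Graph → Set
Complete G = ∀ {u v} → u ≢ v → _~_ G u v

P-symmetric : ∀ k → Symmetric (P k)
P-symmetric k (inj₁ e) = inj₂ e
P-symmetric k (inj₂ e) = inj₁ e

module _ {G H : Graph} where

  □-symmetric : Symmetric G → Symmetric H → Symmetric (G □ H)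
  □-symmetric symG symH (inj₁ (g≡g' , h~h')) = inj₁ (sym g≡g' , symH h~h')
  □-symmetric symG symH (inj₂ (h≡h' , g~g')) = inj₂ (sym h≡h' , symG g~g')

  ∘L-symmetric : Symmetric G → Symmetric H → Symmetric (G ∘L H)
  ∘L-symmetric symG symH (inj₁ g~g')           = inj₁ (symG g~g')
  ∘L-symmetric symG symH (inj₂ (g≡g' , h~h')) = inj₂ (sym g≡g' , symH h~h')

  □⊆∘L : ∀ {u v} → _~_ (G □ H) u v → _~_ (G ∘L H) u v
  □⊆∘L (inj₁ g≡g'×h~h')  = inj₂ g≡g'×h~h'
  □⊆∘L (inj₂ (_ , g~g')) = inj₁ g~g'

  ∘L-complete : DecidableEquality (V G) → Complete G → Complete H → Complete (G ∘L H)
  ∘L-complete _≟_ completeG completeH {g , h} {g' , h'} ≢ with g ≟ g'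
  ... | yes refl = inj₂ (refl , completeH (λ h≡h' → ≢ (cong (g ,_) h≡h')))
  ... | no g≢g'  = inj₁ (completeG g≢g')

P2-complete : Complete (P 2)
P2-complete {fzero}      {fzero}      ≢ = ⊥-elim (≢ refl)
P2-complete {fzero}      {fsuc fzero} _ = inj₁ refl
P2-complete {fsuc fzero} {fzero}      _ = inj₂ refl
P2-complete {fsuc fzero} {fsuc fzero} ≢ = ⊥-elim (≢ refl)

module _ {G : Graph} where

  PCColourable⇒1≤ : ∀ {k} → V G → PCColourable G k → 1 ≤ k
  PCColourable⇒1≤ {zero}  u (c , _) with col c u u
  ... | ()
  PCColourable⇒1≤ {suc k} u _ = s≤s z≤n

  oneColour-properPath : (c : Colouring G 1) {u v : V G} (ps : List (V G)) →
                         ProperPath G c u v ps → u ≡ v ⊎ _~_ G u v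
  oneColour-properPath c (x ∷ []) (hd , lt , _) =
    inj₁ (trans (sym (just-injective hd)) (just-injective lt))
  oneColour-properPath c (x ∷ y ∷ []) (hd , lt , _ , (x~y , _) , _)
    rewrite just-injective hd | just-injective lt = inj₂ x~y
  oneColour-properPath c (x ∷ y ∷ z ∷ _) (_ , _ , _ , _ , (≢ , _)) with col c x y | col c y z
  ... | fzero | fzero = ⊥-elim (≢ refl)

  nonadjacent⇒2≤ : ∀ {u v k} → u ≢ v → ¬ _~_ G u v → PCColourable G k → 2 ≤ k
  nonadjacent⇒2≤ {u} {k = zero} _ _ pc with PCColourable⇒1≤ u pc
  ... | ()
  nonadjacent⇒2≤ {u} {v} {k = suc zero} u≢v u≁v (c , connected)
    with connected u v u≢v
  ... | ps , path with oneColour-properPath c ps path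
  ...   | inj₁ u≡v = ⊥-elim (u≢v u≡v)
  ...   | inj₂ u~v = ⊥-elim (u≁v u~v)
  nonadjacent⇒2≤ {k = suc (suc k)} _ _ _ = s≤s (s≤s z≤n)

  complete⇒1-colourable : Complete G → PCColourable G 1
  complete⇒1-colourable complete = monochrome , λ u v u≢v →
    u ∷ v ∷ [] , refl , refl , ((u≢v ∷ []) ∷ [] ∷ []) , (complete u≢v , tt) , tt
    where
    monochrome : Colouring G 1
    monochrome = record { col = λ _ _ → fzero ; sym = λ _ _ _ → refl }

module _ {G : Graph} {k} (c : Colouring G k) where

  record ProperWalk (w : ℕ → V G) (d : ℕ) : Set where
    field
      step      : ∀ {t} → t < d → _~_ G (w t) (w (suc t))
      distinct  : ∀ {s t} → s < t → t ≤ d → w s ≢ w t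
      alternate : ∀ {t} → suc t < d →
                  col c (w t) (w (suc t)) ≢ col c (w (suc t)) (w (suc (suc t)))

  consecutive-applyUpTo : ∀ w d → (∀ {t} → t < d → _~_ G (w t) (w (suc t))) →
                          Consecutive G (applyUpTo w (suc d))
  consecutive-applyUpTo w zero    step = tt
  consecutive-applyUpTo w (suc d) step =
    step (s≤s z≤n) , consecutive-applyUpTo (λ t → w (suc t)) d (λ t<d → step (s≤s t<d))

  properColours-applyUpTo : ∀ w d →
    (∀ {t} → suc t < d → col c (w t) (w (suc t)) ≢ col c (w (suc t)) (w (suc (suc t)))) →
    ProperColours G c (applyUpTo w (suc d))
  properColours-applyUpTo w zero          alt = tt
  properColours-applyUpTo w (suc zero)    alt = tt
  properColours-applyUpTo w (suc (suc d)) alt =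
    alt (s≤s (s≤s z≤n)) , properColours-applyUpTo (λ t → w (suc t)) (suc d) (λ t<d → alt (s≤s t<d))

  ProperWalk⇒ProperPath : ∀ {w d} → ProperWalk w d →
                          ProperPath G c (w 0) (w d) (applyUpTo w (suc d))
  ProperWalk⇒ProperPath {w} {d} walk =
    refl ,
    last-applyUpTo w d ,
    Unique.applyUpTo⁺₁ w (suc d) (λ s<t t<1+d → distinct s<t (≤-pred t<1+d)) ,
    consecutive-applyUpTo w d step ,
    properColours-applyUpTo w d alternate
    where open ProperWalk walk

  properPath-of-walk : ∀ {w d u v} → ProperWalk w d → w 0 ≡ u → w d ≡ v →
                       ∃ (ProperPath G c u v)
  properPath-of-walk walk refl refl = _ , ProperWalk⇒ProperPath walk

  alternate-reverse : Symmetric G → ∀ {x y z} → _~_ G x y → _~_ G y z →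
                      col c x y ≢ col c y z → col c z y ≢ col c y x
  alternate-reverse symG x~y y~z ≢ zy≡yx =
    ≢ (trans (Colouring.sym c _ _ x~y) (trans (sym zy≡yx) (Colouring.sym c _ _ (symG y~z))))

  ProperWalk-reverse : Symmetric G → ∀ {w d} → ProperWalk w d → ProperWalk (λ t → w (d ∸ t)) d
  ProperWalk-reverse symG {w} {d} walk = record
    { step      = step′
    ; distinct  = λ {s} s<t t≤d → distinct (∸-monoʳ-< s<t t≤d) (m∸n≤m d s) ∘ sym
    ; alternate = alternate′
    }
    where
    open ProperWalk walk

    step′ : ∀ {t} → t < d → _~_ G (w (d ∸ t)) (w (d ∸ suc t))
    step′ {t} t<d rewrite sym (suc[m∸1+n]≡m∸n t<d) = symG (step (m∸[1+n]<m t<d))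

    alternate′ : ∀ {t} → suc t < d →
                 col c (w (d ∸ t)) (w (d ∸ suc t)) ≢ col c (w (d ∸ suc t)) (w (d ∸ suc (suc t)))
    alternate′ {t} 1+t<d
      rewrite sym (suc[m∸1+n]≡m∸n (<⇒≤ 1+t<d)) | sym (suc[m∸1+n]≡m∸n 1+t<d) =
      alternate-reverse symG (step (m∸[1+n]<m 1+t<d)) (step 1+e<d) (alternate 1+e<d)
      where
      1+e<d : suc (d ∸ suc (suc t)) < d
      1+e<d = subst (_< d) (sym (suc[m∸1+n]≡m∸n 1+t<d)) (m∸[1+n]<m (<⇒≤ 1+t<d))

-- The path visits vertex 0, …, vertex len; vertex is unconstrained beyond len.
record HamiltonianPath (G : Graph) : Set where
  field
    len          : ℕ
    vertex       : ℕ → V G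
    index        : V G → ℕ
    index≤len    : ∀ v → index v ≤ len
    vertex-index : ∀ v → vertex (index v) ≡ v
    index-vertex : ∀ {i} → i ≤ len → index (vertex i) ≡ i
    edge         : ∀ {i} → i < len → _~_ G (vertex i) (vertex (suc i))

parity : ∀ {k} → ℕ → Fin (2 + k)
parity zero          = fzero
parity (suc zero)    = fsuc fzero
parity (suc (suc n)) = parity n

parity-suc : ∀ {k} n → parity {k} n ≢ parity (suc n)
parity-suc zero          ()
parity-suc (suc zero)    ()
parity-suc (suc (suc n)) = parity-suc n

module _ {G : Graph} (ham : HamiltonianPath G) {k : ℕ} where
  open HamiltonianPath ham

  alternating : Colouring G (2 + k)
  alternating = record
    { col = λ u v → parity (index u ⊓ index v)
    ; sym = λ u v _ → cong parity (⊓-comm (index u) (index v))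
    }

  edge-colour : ∀ {i} → i < len → col alternating (vertex i) (vertex (suc i)) ≡ parity i
  edge-colour {i} i<len = cong parity (begin
    index (vertex i) ⊓ index (vertex (suc i)) ≡⟨ cong₂ _⊓_ (index-vertex (<⇒≤ i<len)) (index-vertex i<len) ⟩
    i ⊓ suc i                                 ≡⟨ m≤n⇒m⊓n≡m (n≤1+n i) ⟩
    i                                         ∎)
    where open ≡-Reasoning

  segment : ∀ {i j} → i ≤ j → j ≤ len → ProperWalk alternating (λ t → vertex (t + i)) (j ∸ i)
  segment {i} {j} i≤j j≤len = record
    { step      = λ t<d → edge (below t<d)
    ; distinct  = λ {s} {t} s<t t≤d s+i≡t+i →
        <⇒≢ (+-monoˡ-< i s<t) (begin
          s + i                  ≡⟨ index-vertex (<⇒≤ (below (<-≤-trans s<t t≤d))) ⟨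
          index (vertex (s + i)) ≡⟨ cong index s+i≡t+i ⟩
          index (vertex (t + i)) ≡⟨ index-vertex (within t≤d) ⟩
          t + i                  ∎)
    ; alternate = λ {t} 1+t<d same → parity-suc (t + i)
        (trans (sym (edge-colour (below (<⇒≤ 1+t<d)))) (trans same (edge-colour (below 1+t<d))))
    }
    where
    open ≡-Reasoning

    within : ∀ {t} → t ≤ j ∸ i → t + i ≤ len
    within t≤d = ≤-trans (subst (_ ≤_) (m∸n+n≡m i≤j) (+-monoˡ-≤ i t≤d)) j≤len

    -- suc t + i reduces to suc (t + i)
    below : ∀ {t} → t < j ∸ i → t + i < len
    below t<d = within t<d

  vertex-[j∸i]+i : ∀ {x y} → index x ≤ index y → vertex ((index y ∸ index x) + index x) ≡ y
  vertex-[j∸i]+i {x} {y} ix≤iy = trans (cong vertex (m∸n+n≡m ix≤iy)) (vertex-index y)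

  properPath : Symmetric G → ∀ u v → ∃ (ProperPath G alternating u v)
  properPath symG u v with ≤-total (index u) (index v)
  ... | inj₁ iu≤iv = properPath-of-walk alternating (segment iu≤iv (index≤len v))
                       (vertex-index u) (vertex-[j∸i]+i iu≤iv)
  ... | inj₂ iv≤iu = properPath-of-walk alternating
                       (ProperWalk-reverse alternating symG (segment iv≤iu (index≤len u)))
                       (vertex-[j∸i]+i iv≤iu)
                       (trans (cong (vertex ∘ (_+ index v)) (n∸n≡0 (index u ∸ index v))) (vertex-index v))

hamiltonian⇒PCColourable : ∀ {G} → Symmetric G → HamiltonianPath G → ∀ k → PCColourable G (2 + k)
hamiltonian⇒PCColourable symG ham k = alternating ham , λ u v _ → properPath ham symG u v

P-hamiltonian : ∀ b → HamiltonianPath (P (suc b))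
P-hamiltonian b = record
  { len          = b
  ; vertex       = λ i → i mod suc b
  ; index        = toℕ
  ; index≤len    = toℕ≤pred[n]
  ; vertex-index = λ x → toℕ-injective (toℕ-mod (toℕ≤pred[n] x))
  ; index-vertex = toℕ-mod
  ; edge         = λ i<b → inj₁ (trans (toℕ-mod i<b) (cong suc (sym (toℕ-mod (<⇒≤ i<b)))))
  }
  where
  toℕ-mod : ∀ {i} → i ≤ b → toℕ (i mod suc b) ≡ i
  toℕ-mod i≤b = trans (toℕ-fromℕ< _) (m≤n⇒m%n≡m i≤b)

module _ {G H : Graph} (symH : Symmetric H) (hamG : HamiltonianPath G) (hamH : HamiltonianPath H) where
  private
    module G′ = HamiltonianPath hamG
    module H′ = HamiltonianPath hamH
    a = G′.len
    b = H′.len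
    m = suc b

  -- The vertex r + g * m of the product lies in row g, at position snake g r of H:
  -- even rows traverse H forwards, odd rows backwards.
  snake : ℕ → ℕ → ℕ
  snake zero          r = r
  snake (suc zero)    r = b ∸ r
  snake (suc (suc g)) r = snake g r

  snake-≤ : ∀ g {r} → r ≤ b → snake g r ≤ b
  snake-≤ zero              r≤b = r≤b
  snake-≤ (suc zero)    {r} _   = m∸n≤m b r
  snake-≤ (suc (suc g))     r≤b = snake-≤ g r≤b

  snake-involutive : ∀ g {r} → r ≤ b → snake g (snake g r) ≡ r
  snake-involutive zero          r≤b = refl
  snake-involutive (suc zero)    r≤b = m∸[m∸n]≡n r≤b
  snake-involutive (suc (suc g)) r≤b = snake-involutive g r≤b

  snake-turn : ∀ g → snake (suc g) 0 ≡ snake g b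
  snake-turn zero          = refl
  snake-turn (suc zero)    = sym (n∸n≡0 b)
  snake-turn (suc (suc g)) = snake-turn g

  snake-edge : ∀ g {r} → r < b → _~_ H (H′.vertex (snake g r)) (H′.vertex (snake g (suc r)))
  snake-edge zero          r<b = H′.edge r<b
  snake-edge (suc zero)    r<b rewrite sym (suc[m∸1+n]≡m∸n r<b) = symH (H′.edge (m∸[1+n]<m r<b))
  snake-edge (suc (suc g)) r<b = snake-edge g r<b

  private
    vertex : ℕ → V (G □ H)
    vertex k = G′.vertex (k / m) , H′.vertex (snake (k / m) (k % m))

    index : V (G □ H) → ℕ
    index (x , y) = snake (G′.index x) (H′.index y) + G′.index x * m

    len : ℕ
    len = b + a * m

    divMod-elim : (Q : ℕ → Set) → (∀ g {r} → r ≤ b → Q (r + g * m)) → ∀ k → Q k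
    divMod-elim Q q k = subst Q (sym (m≡m%n+[m/n]*n k m)) (q (k / m) (≤-pred (m%n<n k m)))

    vertex-decomp : ∀ g {r} → r ≤ b → vertex (r + g * m) ≡ (G′.vertex g , H′.vertex (snake g r))
    vertex-decomp g r≤b rewrite m<n⇒[m+kn]/n≡k g (s≤s r≤b) | m<n⇒[m+kn]%n≡m g (s≤s r≤b) = refl

    row≤ : ∀ {g r} → r + g * m ≤ len → g ≤ a
    row≤ {g} {r} r+gm≤len = ≤-pred (*-cancelʳ-< m g (suc a) (begin-strict
      g * m       ≤⟨ m≤n+m (g * m) r ⟩
      r + g * m   ≤⟨ r+gm≤len ⟩
      b + a * m   <⟨ +-monoˡ-< (a * m) (n<1+n b) ⟩
      suc a * m   ∎))
      where open ≤-Reasoning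

    last-row<a : ∀ {g} → b + g * m < len → g < a
    last-row<a {g} lt = *-cancelʳ-< m g a (+-cancelˡ-< b (g * m) (a * m) lt)

    index-vertex : ∀ {k} → k ≤ len → index (vertex k) ≡ k
    index-vertex {k} = divMod-elim (λ k → k ≤ len → index (vertex k) ≡ k) decomposed k
      where
      decomposed : ∀ g {r} → r ≤ b → r + g * m ≤ len → index (vertex (r + g * m)) ≡ r + g * m
      decomposed g {r} r≤b r+gm≤len = begin
        index (vertex (r + g * m))
          ≡⟨ cong index (vertex-decomp g r≤b) ⟩
        snake (G′.index (G′.vertex g)) (H′.index (H′.vertex (snake g r))) + G′.index (G′.vertex g) * m
          ≡⟨ cong (λ i → snake i (H′.index (H′.vertex (snake g r))) + i * m) (G′.index-vertex (row≤ r+gm≤len)) ⟩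
        snake g (H′.index (H′.vertex (snake g r))) + g * m
          ≡⟨ cong (λ j → snake g j + g * m) (H′.index-vertex (snake-≤ g r≤b)) ⟩
        snake g (snake g r) + g * m
          ≡⟨ cong (_+ g * m) (snake-involutive g r≤b) ⟩
        r + g * m ∎
        where open ≡-Reasoning

    edge : ∀ {k} → k < len → _~_ (G □ H) (vertex k) (vertex (suc k))
    edge {k} = divMod-elim (λ k → k < len → _~_ (G □ H) (vertex k) (vertex (suc k))) decomposed k
      where
      decomposed : ∀ g {r} → r ≤ b → r + g * m < len →
                   _~_ (G □ H) (vertex (r + g * m)) (vertex (suc r + g * m))
      decomposed g {r} r≤b lt with m≤n⇒m<n∨m≡n r≤b
      ... | inj₁ r<b = subst₂ (_~_ (G □ H)) (sym (vertex-decomp g r≤b)) (sym (vertex-decomp g r<b))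
        (inj₁ (refl , snake-edge g r<b))
      ... | inj₂ refl = subst₂ (_~_ (G □ H)) (sym (vertex-decomp g r≤b)) (sym (vertex-decomp (suc g) z≤n))
        (inj₂ (cong H′.vertex (sym (snake-turn g)) , G′.edge (last-row<a lt)))

  □-hamiltonian : HamiltonianPath (G □ H)
  □-hamiltonian = record
    { len          = len
    ; vertex       = vertex
    ; index        = index
    ; index≤len    = λ (x , y) → +-mono-≤ (snake-≤ (G′.index x) (H′.index≤len y)) (*-monoˡ-≤ m (G′.index≤len x))
    ; vertex-index = vertex-index
    ; index-vertex = index-vertex
    ; edge         = edge
    }
    where
    vertex-index : ∀ v → vertex (index v) ≡ v
    vertex-index (x , y) = begin
      vertex (snake (G′.index x) (H′.index y) + G′.index x * m)
        ≡⟨ vertex-decomp (G′.index x) (snake-≤ (G′.index x) (H′.index≤len y)) ⟩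
      G′.vertex (G′.index x) , H′.vertex (snake (G′.index x) (snake (G′.index x) (H′.index y)))
        ≡⟨ cong₂ _,_ (G′.vertex-index x)
             (trans (cong H′.vertex (snake-involutive (G′.index x) (H′.index≤len y))) (H′.vertex-index y)) ⟩
      x , y ∎
      where open ≡-Reasoning

∘L-hamiltonian : ∀ {G H} → HamiltonianPath (G □ H) → HamiltonianPath (G ∘L H)
∘L-hamiltonian {G} {H} ham = record { HamiltonianPath ham ; edge = □⊆∘L {G} {H} ∘ HamiltonianPath.edge ham }

grid-symmetric : ∀ n m → Symmetric (P n □ P m)
grid-symmetric n m = □-symmetric {P n} {P m} (P-symmetric n) (P-symmetric m)

grid-hamiltonian : ∀ a b → HamiltonianPath (P (suc a) □ P (suc b))
grid-hamiltonian a b = □-hamiltonian (P-symmetric (suc b)) (P-hamiltonian a) (P-hamiltonian b)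

grid-PCColourable : ∀ a b k → PCColourable (P (suc a) □ P (suc b)) (2 + k)
grid-PCColourable a b = hamiltonian⇒PCColourable (grid-symmetric _ _) (grid-hamiltonian a b)

lex-PCColourable : ∀ a b k → PCColourable (P (suc a) ∘L P (suc b)) (2 + k)
lex-PCColourable a b =
  hamiltonian⇒PCColourable (∘L-symmetric {P (suc a)} {P (suc b)} (P-symmetric _) (P-symmetric _))
    (∘L-hamiltonian (grid-hamiltonian a b))

grid-2≤ : ∀ a b {j} → PCColourable (P (2 + a) □ P (2 + b)) j → 2 ≤ j
grid-2≤ a b = nonadjacent⇒2≤ {u = fzero , fzero} {v = fsuc fzero , fsuc fzero} (λ ())
  λ { (inj₁ (() , _)) ; (inj₂ (() , _)) }

lex-2≤ : ∀ a b {j} → 2 < 2 + a ⊎ 2 < 2 + b → PCColourable (P (2 + a) ∘L P (2 + b)) j → 2 ≤ j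
lex-2≤ zero    _       (inj₁ (s≤s (s≤s ())))
lex-2≤ _       zero    (inj₂ (s≤s (s≤s ())))
lex-2≤ (suc a) b       (inj₁ _) = nonadjacent⇒2≤ {u = fzero , fzero} {v = fsuc (fsuc fzero) , fzero} (λ ())
  λ { (inj₁ (inj₁ ())) ; (inj₁ (inj₂ ())) ; (inj₂ (() , _)) }
lex-2≤ a       (suc b) (inj₂ _) = nonadjacent⇒2≤ {u = fzero , fzero} {v = fzero , fsuc (fsuc fzero)} (λ ())
  λ { (inj₁ (inj₁ ())) ; (inj₁ (inj₂ ())) ; (inj₂ (_ , inj₁ ())) ; (inj₂ (_ , inj₂ ())) }

K₄-PC≡1 : PC≡ (P 2 ∘L P 2) 1
K₄-PC≡1 = complete⇒1-colourable (∘L-complete Fin._≟_ P2-complete P2-complete) ,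
          λ j → PCColourable⇒1≤ (fzero , fzero)

proposition3 : (∀ n m → 2 ≤ n → 2 ≤ m →
    PCColourable (P n □ P m) 3 × (∀ j → PCColourable (P n □ P m) j → 2 ≤ j))
    ×
    (∀ n m → 2 ≤ n → 2 ≤ m →
    ((m ≡ 2 × n ≡ 2) → PC≡ (P n ∘L P m) 1)
    × (((m ≡ 2 × 2 < n) ⊎ (n ≡ 2 × 2 < m) ⊎ (2 < m × 2 < n)) → PC≡ (P n ∘L P m) 2))
proposition3 = grid , λ n m 2≤n 2≤m → (λ { (refl , refl) → K₄-PC≡1 }) , lexicographic n m 2≤n 2≤m
  where
  grid : ∀ n m → 2 ≤ n → 2 ≤ m →
         PCColourable (P n □ P m) 3 × (∀ j → PCColourable (P n □ P m) j → 2 ≤ j)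
  grid (suc (suc a)) (suc (suc b)) (s≤s (s≤s _)) (s≤s (s≤s _)) =
    grid-PCColourable (suc a) (suc b) 1 , λ j → grid-2≤ a b

  lexicographic : ∀ n m → 2 ≤ n → 2 ≤ m →
    ((m ≡ 2 × 2 < n) ⊎ (n ≡ 2 × 2 < m) ⊎ (2 < m × 2 < n)) → PC≡ (P n ∘L P m) 2
  lexicographic (suc (suc a)) (suc (suc b)) (s≤s (s≤s _)) (s≤s (s≤s _)) shape =
    lex-PCColourable (suc a) (suc b) 0 ,
    λ j → lex-2≤ a b ([ inj₁ ∘ proj₂ , [ inj₂ ∘ proj₂ , inj₁ ∘ proj₂ ]′ ]′ shape)
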